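{- Let $p\in(0,1)$. For $n\ge 1$, consider the transitive tournament on vertex set $\{1,\dots,n\}$ with directed edges $(i,j)$ for all $1\le i<j\le n$, where the edges carry independent random weights with the Bernoulli distribution $\mathcal{B}(p)$. Let $X_n$ be the maximum weight of a directed path from vertex $1$ to vertex $n$. Define $g(n)=1+\mathbb{E}[X_n]$ for $n\ge1$ and $g(0)=1$, and let $G_p(x)=\sum_{n\ge0} g(n)x^n$ and $B_p(x)=\sum_{n\ge0}(1-p)^{\binom{n+1}{2}}x^n$. Then, as formal power series in $x$, \[ G_p(x) = 1+\frac{x}{(1-x)^2B_p(x)}. \]
   Context: $\mathcal{B}(p)$ is the distribution of a random variable equal to $1$ with probability $p$ and $0$ with probability $1-p$. The weight of a directed path is the sum of the weights of its edges; the path from $1$ to $1$ (trivial path) has weight $0$, so $X_1=0$.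
   Formalization: The parameter p ranges over the rationals in $(0,1)$. -}

module Defs where

open import Data.Bool using (Bool; true; false; if_then_else_)
open import Data.Nat as ℕ using (ℕ; zero; suc; _∸_)
open import Data.Nat.Combinatorics using (_C_)
open import Data.Fin as Fin using (Fin; combine; fromℕ)
open import Data.Integer using (+_)
open import Data.Rational using (ℚ; _+_; _*_; _-_; -_; 0ℚ; 1ℚ; _/_)
open import Data.List using (List; []; _∷_; map; foldr; upTo; zipWith; head; last)
open import Data.List.Relation.Unary.Linked using (Linked)
open import Data.Maybe using (Maybe; just; nothing)
open import Data.Product using (_×_; Σ)
open import Relation.Binary.PropositionalEquality using (_≡_)

ℕ→ℚ : ℕ → ℚ
ℕ→ℚ n = (+ n) / 1

_^ℚ_ : ℚ → ℕ → ℚ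
q ^ℚ zero  = 1ℚ
q ^ℚ suc n = q * (q ^ℚ n)

sumℚ : List ℚ → ℚ
sumℚ = foldr _+_ 0ℚ

Series : Set
Series = ℕ → ℚ

oneS : Series
oneS zero    = 1ℚ
oneS (suc _) = 0ℚ

xS : Series
xS (suc zero) = 1ℚ
xS _          = 0ℚ

_+S_ : Series → Series → Series
(a +S b) n = a n + b n

_*S_ : Series → Series → Series
(a *S b) n = sumℚ (map (λ k → a k * b (n ∸ k)) (upTo (suc n)))

oneMinusX : Series
oneMinusX zero          = 1ℚ
oneMinusX (suc zero)    = - 1ℚ
oneMinusX (suc (suc _)) = 0ℚ

-- Multiplicative inverse of a series a with constant term a 0 = 1:
-- inv a 0 = 1, inv a (n+1) = - Σ_{k=1}^{n+1} a k * inv a (n+1-k).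
-- invList a n = [inv a n , inv a (n-1) , … , inv a 0].
invList : Series → ℕ → List ℚ
invList a zero    = 1ℚ ∷ []
invList a (suc n) =
  let L = invList a n in
  (- sumℚ (zipWith _*_ (map (λ k → a (suc k)) (upTo (suc n))) L)) ∷ L

inv₁ : Series → Series
inv₁ a n with invList a n
... | c ∷ _ = c
... | []    = 0ℚ

-- Expectation over independent Bernoulli(p) bits indexed by Fin k
-- (bit true = weight 1 with probability p, false = weight 0 w.p. 1-p)

expect : ℚ → (k : ℕ) → ((Fin k → Bool) → ℚ) → ℚ
expect p zero    f = f (λ ())
expect p (suc k) f =
    p * expect p k (λ ω → f (λ { Fin.zero → true ; (Fin.suc i) → ω i }))
  + (1ℚ - p) * expect p k (λ ω → f (λ { Fin.zero → false ; (Fin.suc i) → ω i }))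

-- The random weighted transitive tournament on n vertices (Fin n,
-- vertex i of Fin n is vertex i+1 of the paper).  A configuration
-- assigns an independent bit to each ordered pair (i , j); only the
-- pairs with i < j (the edges) are ever used.

Config : ℕ → Set
Config n = Fin (n ℕ.* n) → Bool

edgeW : {n : ℕ} → Config n → Fin n → Fin n → ℕ
edgeW ω i j = if ω (combine i j) then 1 else 0

pathWeight : {n : ℕ} → (Fin n → Fin n → ℕ) → List (Fin n) → ℕ
pathWeight w []            = 0
pathWeight w (_ ∷ [])      = 0
pathWeight w (u ∷ v ∷ vs)  = w u v ℕ.+ pathWeight w (v ∷ vs)

IsPath : (m : ℕ) → List (Fin (suc m)) → Set
IsPath m vs = (head vs ≡ just Fin.zero) × (last vs ≡ just (fromℕ m)) × Linked Fin._<_ vs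

IsMaxPathWeight : (m : ℕ) → (Fin (suc m) → Fin (suc m) → ℕ) → ℕ → Set
IsMaxPathWeight m w x =
  Σ (List (Fin (suc m))) (λ vs → IsPath m vs × (pathWeight w vs ≡ x))
  × ((vs : List (Fin (suc m))) → IsPath m vs → pathWeight w vs ℕ.≤ x)

-- g, G_p, B_p.  X m ω is the value of X_{m+1} on configuration ω.

gSeries : ℚ → ((m : ℕ) → Config (suc m) → ℕ) → Series
gSeries p X zero    = 1ℚ
gSeries p X (suc m) = 1ℚ + expect p (suc m ℕ.* suc m) (λ ω → ℕ→ℚ (X m ω))

BSeries : ℚ → Series
BSeries p n = (1ℚ - p) ^ℚ (suc n C 2)

{-# OPTIONS --safe #-}
module Submission where

-- Number the vertices 0, …, n (vertex i is the paper's i + 1) and build the tournament by adding new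
-- first vertices one at a time.  Let c be the maximum weight of a path ending at the last vertex and
-- {0, …, e} the set of vertices from which a path of weight c starts (from every later vertex all paths
-- are lighter).  When a new first vertex is added, c stays and e grows by one if all its edges into
-- {0, …, e} have weight 0, which happens with probability q^(e+1) where q = 1 - p; otherwise c grows by
-- one and e becomes 0.  So (c, e) is a Markov chain.  If r n is the probability that e = 0 after n steps
-- (c has just grown), then P(e = k) = q^C(k+1,2) r (n - k) after n steps; summing over k gives
-- B_p · r = 1/(1 - x), and E[c] = r 1 + … + r n.  Hence g(n + 1) = r 0 + … + r n, that is,
-- G_p = 1 + x r/(1 - x) = 1 + x/((1 - x)² B_p).

open import Defs
open import Data.Bool using (Bool; true; false; if_then_else_; not; _∧_; T)
open import Data.Bool.Properties using (if-float)
open import Data.Nat as ℕ using (ℕ; zero; suc; _∸_; z≤n; s≤s)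
import Data.Nat.Properties as ℕ
open import Data.Nat.Combinatorics using (_C_; nC1≡n; nCk+nC[k+1]≡[n+1]C[k+1])
import Data.Nat.Coprimality as Coprime
import Data.Integer as ℤ
import Data.Integer.Properties as ℤ
open import Data.Fin as Fin using (Fin; toℕ; fromℕ; fromℕ<; combine; _↑ˡ_; _↑ʳ_; splitAt)
import Data.Fin.Properties as Fin
open import Data.Sum.Properties using ([,]-map)
open import Data.Vec.Functional as Vector using (Vector; _++_; head; tail; take; drop)
open import Data.Vec.Functional.Properties using (∷-cong; ++-cong; lookup-++ˡ; lookup-++ʳ)
open import Data.List using ([]; _∷_; map; upTo; applyUpTo; zipWith; last)
open import Data.List.Properties using (map-cong; map-cong-local; map-applyUpTo; map-upTo)
open import Data.List.Relation.Unary.All.Properties using (applyUpTo⁺₁)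
open import Data.List.Relation.Unary.Linked using (Linked; [-]; _∷_)
open import Data.Maybe using (just)
open import Data.Maybe.Properties using (just-injective)
open import Data.Product using (_×_; _,_; proj₁; proj₂; ∃-syntax)
open import Function using (_∘_; id)
open import Function.Definitions using (Congruent)
open import Relation.Nullary using (yes; no; contradiction)
open import Relation.Binary.PropositionalEquality

module TransitiveTournament where
  open import Data.Nat using (_+_; _*_; _≤_; _<_; _≤?_)
  open import Data.Nat.Properties using (≤-refl; ≤-trans; <⇒≤; <⇒≱; ≰⇒>; ≤-antisym; ≤-reflexive;
                                         m≤n+m; m≤n⇒m≤1+n; +-mono-≤; +-monoˡ-≤)

  Weights : Set
  Weights = ℕ → ℕ → Bool

  weight : Bool → ℕ
  weight b = if b then 1 else 0

  weight≤1 : ∀ b → weight b ≤ 1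
  weight≤1 true  = s≤s z≤n
  weight≤1 false = z≤n

  tailW : Weights → Weights
  tailW w i j = w (suc i) (suc j)

  data Path (w : Weights) (t : ℕ) : ℕ → ℕ → Set where
    stop : Path w t t 0
    step : ∀ {u v x} → u < v → Path w t v x → Path w t u (weight (w u v) + x)

  Path-start≤end : ∀ {w t u x} → Path w t u x → u ≤ t
  Path-start≤end stop         = ≤-refl
  Path-start≤end (step u<v P) = ≤-trans (<⇒≤ u<v) (Path-start≤end P)

  Path-to-0-weight≡0 : ∀ {w u x} → Path w 0 u x → x ≡ 0
  Path-to-0-weight≡0 stop = refl
  Path-to-0-weight≡0 (step u<v P) with Path-start≤end P
  Path-to-0-weight≡0 (step () P) | z≤n

  Path-lift : ∀ {w t u x} → Path (tailW w) t u x → Path w (suc t) (suc u) x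
  Path-lift stop         = stop
  Path-lift (step u<v P) = step (s≤s u<v) (Path-lift P)

  Path-lower : ∀ {w t u x} → Path w (suc t) (suc u) x → Path (tailW w) t u x
  Path-lower stop                           = stop
  Path-lower (step {v = suc v} (s≤s u<v) P) = step u<v (Path-lower P)

  noneUpTo : (ℕ → Bool) → ℕ → Bool
  noneUpTo r zero    = not (r 0)
  noneUpTo r (suc e) = not (r 0) ∧ noneUpTo (r ∘ suc) e

  noneUpTo-true : ∀ r e → noneUpTo r e ≡ true → ∀ {b} → b ≤ e → r b ≡ false
  noneUpTo-true r zero none z≤n with r 0
  ... | false = refl
  noneUpTo-true r (suc e) none b≤e with r 0 in r₀
  noneUpTo-true r (suc e) none z≤n       | false = r₀
  noneUpTo-true r (suc e) none (s≤s b≤e) | false = noneUpTo-true (r ∘ suc) e none b≤e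

  noneUpTo-false : ∀ r e → noneUpTo r e ≡ false → ∃[ b ] b ≤ e × r b ≡ true
  noneUpTo-false r zero some with r 0 in r₀
  ... | true = 0 , z≤n , r₀
  noneUpTo-false r (suc e) some with r 0 in r₀
  ... | true  = 0 , z≤n , r₀
  ... | false with noneUpTo-false (r ∘ suc) e some
  ...   | b , b≤e , r₁₊b≡true = suc b , s≤s b≤e , r₁₊b≡true

  noneUpTo-cong : ∀ {r r′} e → (∀ {b} → b ≤ e → r b ≡ r′ b) → noneUpTo r e ≡ noneUpTo r′ e
  noneUpTo-cong zero    r≡r′ = cong not (r≡r′ z≤n)
  noneUpTo-cong (suc e) r≡r′ = cong₂ _∧_ (cong not (r≡r′ z≤n)) (noneUpTo-cong e (r≡r′ ∘ s≤s))

  -- r b is the weight of the edge from the new first vertex to the old vertex b.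
  advance : ℕ × ℕ → (ℕ → Bool) → ℕ × ℕ
  advance (c , e) r = if noneUpTo r e then (c , suc e) else (suc c , 0)

  state : ℕ → Weights → ℕ × ℕ
  state zero    w = (0 , 0)
  state (suc n) w = advance (state n (tailW w)) (λ b → w 0 (suc b))

  state-bound : ∀ n w → proj₂ (state n w) ≤ n
  state-bound zero    w = z≤n
  state-bound (suc n) w with noneUpTo (λ b → w 0 (suc b)) (proj₂ (state n (tailW w)))
  ... | true  = s≤s (state-bound n (tailW w))
  ... | false = z≤n

  record Describes (n : ℕ) (w : Weights) (c e : ℕ) : Set where
    field
      attained : ∀ {b} → b ≤ e → ∃[ x ] Path w n b x × c ≤ x
      bounded  : ∀ {u x} → Path w n u x → x ≤ c
      strict   : ∀ {u x} → e < u → Path w n u x → x < c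

  module _ {n w c e} (D : Describes n (tailW w) c e) where
    open Describes D
    private
      r : ℕ → Bool
      r b = w 0 (suc b)

    describes-keep : noneUpTo r e ≡ true → Describes (suc n) w c (suc e)
    describes-keep none = record { attained = attained′ ; bounded = bounded′ ; strict = strict′ }
      where
      attained′ : ∀ {b} → b ≤ suc e → ∃[ x ] Path w (suc n) b x × c ≤ x
      attained′ {zero} _ with attained z≤n
      ... | x , P , c≤x = _ , step (s≤s z≤n) (Path-lift P) , ≤-trans c≤x (m≤n+m x _)
      attained′ {suc b} (s≤s b≤e) with attained b≤e
      ... | x , P , c≤x = x , Path-lift P , c≤x
      bounded′ : ∀ {u x} → Path w (suc n) u x → x ≤ c
      bounded′ {suc u} P = bounded (Path-lower P)
      bounded′ {zero} (step {v = suc v} {x} _ P) with v ≤? e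
      ... | yes v≤e rewrite noneUpTo-true r e none v≤e = bounded (Path-lower P)
      ... | no  v≰e = ≤-trans (+-monoˡ-≤ x (weight≤1 (r v))) (strict (≰⇒> v≰e) (Path-lower P))
      strict′ : ∀ {u x} → suc e < u → Path w (suc n) u x → x < c
      strict′ {suc u} (s≤s e<u) P = strict e<u (Path-lower P)

    describes-climb : noneUpTo r e ≡ false → Describes (suc n) w (suc c) 0
    describes-climb some = record { attained = attained′ ; bounded = bounded′ ; strict = strict′ }
      where
      attained′ : ∀ {b} → b ≤ 0 → ∃[ x ] Path w (suc n) b x × suc c ≤ x
      attained′ z≤n with noneUpTo-false r e some
      ... | b , b≤e , r≡true with attained b≤e
      ... | x , P , c≤x =
        _ , step (s≤s z≤n) (Path-lift P) , subst (λ z → suc c ≤ weight z + x) (sym r≡true) (s≤s c≤x)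
      bounded′ : ∀ {u x} → Path w (suc n) u x → x ≤ suc c
      bounded′ {suc u} P                     = m≤n⇒m≤1+n (bounded (Path-lower P))
      bounded′ {zero} (step {v = suc v} _ P) = +-mono-≤ (weight≤1 (r v)) (bounded (Path-lower P))
      strict′ : ∀ {u x} → 0 < u → Path w (suc n) u x → x < suc c
      strict′ {suc u} _ P = s≤s (bounded (Path-lower P))

  state-describes : ∀ n w → Describes n w (proj₁ (state n w)) (proj₂ (state n w))
  state-describes zero w = record
    { attained = λ { z≤n → 0 , stop , z≤n }
    ; bounded  = λ P → ≤-reflexive (Path-to-0-weight≡0 P)
    ; strict   = λ e<u P → contradiction (Path-start≤end P) (<⇒≱ e<u)
    }
  state-describes (suc n) w with noneUpTo (λ b → w 0 (suc b)) (proj₂ (state n (tailW w))) in eq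
  ... | true  = describes-keep  (state-describes n (tailW w)) eq
  ... | false = describes-climb (state-describes n (tailW w)) eq

  EdgeDetermined : {A : Set} → ℕ → (Weights → A) → Set
  EdgeDetermined N φ = ∀ {w w′} → (∀ {i j} → i < j → j < N → w i j ≡ w′ i j) → φ w ≡ φ w′

  state-edgeDetermined : ∀ n → EdgeDetermined (suc n) (state n)
  state-edgeDetermined zero    w≡w′ = refl
  state-edgeDetermined (suc n) {w} {w′} w≡w′
    rewrite state-edgeDetermined n {tailW w} {tailW w′} (λ i<j j<n → w≡w′ (s≤s i<j) (s≤s j<n)) =
    cong (λ none → if none then _ else _) (noneUpTo-cong e (λ b≤e →
      w≡w′ (s≤s z≤n) (s≤s (s≤s (≤-trans b≤e (state-bound n (tailW w′)))))))
    where e = proj₂ (state n (tailW w′))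

  toRow : ∀ {k} → Vector Bool k → ℕ → Bool
  toRow {zero}  v j       = false
  toRow {suc k} v zero    = head v
  toRow {suc k} v (suc j) = toRow (tail v) j

  toMatrix : ∀ r c → Vector Bool (r * c) → Weights
  toMatrix zero    c ω i       = λ _ → false
  toMatrix (suc r) c ω zero    = toRow (take c ω)
  toMatrix (suc r) c ω (suc i) = toMatrix r c (drop c ω) i

  toRow-cong : ∀ {k} {v v′ : Vector Bool k} → v ≗ v′ → ∀ j → toRow v j ≡ toRow v′ j
  toRow-cong {zero}  v≗v′ j       = refl
  toRow-cong {suc k} v≗v′ zero    = v≗v′ Fin.zero
  toRow-cong {suc k} v≗v′ (suc j) = toRow-cong (v≗v′ ∘ Fin.suc) j

  toMatrix-cong : ∀ r c {ω ω′} → ω ≗ ω′ → ∀ i j → toMatrix r c ω i j ≡ toMatrix r c ω′ i j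
  toMatrix-cong zero    c ω≗ω′ i       j = refl
  toMatrix-cong (suc r) c ω≗ω′ zero    j = toRow-cong (ω≗ω′ ∘ (_↑ˡ r * c)) j
  toMatrix-cong (suc r) c ω≗ω′ (suc i) j = toMatrix-cong r c (ω≗ω′ ∘ (c ↑ʳ_)) i j

  toRow-toℕ : ∀ {k} (v : Vector Bool k) j → toRow v (toℕ j) ≡ v j
  toRow-toℕ v Fin.zero    = refl
  toRow-toℕ v (Fin.suc j) = toRow-toℕ (tail v) j

  toMatrix-combine : ∀ r c ω (i : Fin r) (j : Fin c) → toMatrix r c ω (toℕ i) (toℕ j) ≡ ω (combine i j)
  toMatrix-combine (suc r) c ω Fin.zero    j = toRow-toℕ (take c ω) j
  toMatrix-combine (suc r) c ω (Fin.suc i) j = toMatrix-combine r c (drop c ω) i j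

  -- v lists the edges out of the new first vertex, its entry 0 being an unused loop.
  extend : ∀ {n} → Vector Bool (suc n) → Weights → Weights
  extend v w zero    j       = toRow v j
  extend v w (suc i) zero    = false
  extend v w (suc i) (suc j) = w i j

  extend-cong : ∀ {n} (v : Vector Bool (suc n)) {w w′ : Weights} → (∀ i j → w i j ≡ w′ i j) →
                ∀ i j → extend v w i j ≡ extend v w′ i j
  extend-cong v w≡w′ zero    j       = refl
  extend-cong v w≡w′ (suc i) zero    = refl
  extend-cong v w≡w′ (suc i) (suc j) = w≡w′ i j

  dropFirstColumn : ∀ r c → Vector Bool (r * suc c) → Vector Bool (r * c)
  dropFirstColumn zero    c ω = λ ()
  dropFirstColumn (suc r) c ω = tail (take (suc c) ω) ++ dropFirstColumn r c (drop (suc c) ω)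

  dropFirstColumn-cong : ∀ r c {ω ω′} → ω ≗ ω′ → dropFirstColumn r c ω ≗ dropFirstColumn r c ω′
  dropFirstColumn-cong zero    c ω≗ω′ ()
  dropFirstColumn-cong (suc r) c ω≗ω′ =
    ++-cong _ _ (ω≗ω′ ∘ _) (dropFirstColumn-cong r c (ω≗ω′ ∘ (suc c ↑ʳ_)))

  toMatrix-dropFirstColumn : ∀ r c ω i j →
                             toMatrix r (suc c) ω i (suc j) ≡ toMatrix r c (dropFirstColumn r c ω) i j
  toMatrix-dropFirstColumn zero    c ω i       j = refl
  toMatrix-dropFirstColumn (suc r) c ω zero    j =
    toRow-cong (sym ∘ lookup-++ˡ (tail (take (suc c) ω)) (dropFirstColumn r c (drop (suc c) ω))) j
  toMatrix-dropFirstColumn (suc r) c ω (suc i) j =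
    trans (toMatrix-dropFirstColumn r c (drop (suc c) ω) i j)
          (toMatrix-cong r c (sym ∘ lookup-++ʳ (tail (take (suc c) ω)) (dropFirstColumn r c (drop (suc c) ω)))
                         i j)

  module _ {m : ℕ} (ω : Config (suc m)) where
    private
      W : Weights
      W = toMatrix (suc m) (suc m) ω

    edgeW≡weight : ∀ i j → edgeW ω i j ≡ weight (W (toℕ i) (toℕ j))
    edgeW≡weight i j = cong weight (sym (toMatrix-combine (suc m) (suc m) ω i j))

    ListPathFrom : Fin (suc m) → ℕ → Set
    ListPathFrom u x = ∃[ vs ] Linked Fin._<_ (u ∷ vs) × last (u ∷ vs) ≡ just (fromℕ m)
                               × pathWeight (edgeW ω) (u ∷ vs) ≡ x

    fromListPath : ∀ u vs → Linked Fin._<_ (u ∷ vs) → last (u ∷ vs) ≡ just (fromℕ m) →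
                   Path W m (toℕ u) (pathWeight (edgeW ω) (u ∷ vs))
    fromListPath u [] _ last≡m =
      subst (λ t → Path W m t 0) (sym (trans (cong toℕ (just-injective last≡m)) (Fin.toℕ-fromℕ m))) stop
    fromListPath u (v ∷ vs) (u<v ∷ linked) last≡m =
      subst (λ y → Path W m (toℕ u) (y + pathWeight (edgeW ω) (v ∷ vs))) (sym (edgeW≡weight u v))
        (step u<v (fromListPath v vs linked last≡m))

    toListPath : ∀ {u x} → Path W m u x → ∃[ f ] toℕ f ≡ u × ListPathFrom f x
    toListPath stop = fromℕ m , Fin.toℕ-fromℕ m , [] , [-] , refl , refl
    toListPath (step {u} {v} u<v P) with toListPath P
    ... | f , refl , vs , linked , last≡m , refl =
      fu , toℕ-fu , f ∷ vs , subst (_< toℕ f) (sym toℕ-fu) u<v ∷ linked , last≡m ,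
      cong (_+ pathWeight (edgeW ω) (f ∷ vs))
           (trans (edgeW≡weight fu f) (cong (λ i → weight (W i (toℕ f))) toℕ-fu))
      where
      u<1+m : u < suc m
      u<1+m = s≤s (≤-trans (<⇒≤ u<v) (Path-start≤end P))
      fu : Fin (suc m)
      fu = fromℕ< u<1+m
      toℕ-fu : toℕ fu ≡ u
      toℕ-fu = Fin.toℕ-fromℕ< u<1+m

    maxPathWeight≡state : ∀ {x} → IsMaxPathWeight m (edgeW ω) x → x ≡ proj₁ (state m W)
    maxPathWeight≡state ((u ∷ vs , (head≡0 , last≡m , linked) , refl) , maximal)
      with just-injective head≡0
    ... | refl = ≤-antisym (bounded (fromListPath Fin.zero vs linked last≡m)) c≤x
      where
      open Describes (state-describes m W)
      c≤x : proj₁ (state m W) ≤ pathWeight (edgeW ω) (Fin.zero ∷ vs)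
      c≤x with attained z≤n
      ... | y , P , c≤y with toListPath P
      ...   | f , toℕ-f≡0 , ws , linked′ , last′≡m , refl =
        ≤-trans c≤y (maximal (f ∷ ws) (cong just (Fin.toℕ-injective toℕ-f≡0) , last′≡m , linked′))

open TransitiveTournament

open import Data.Rational using (ℚ; 0ℚ; 1ℚ; _+_; _*_; _-_; -_; _/_; _<_)
import Data.Rational.Properties as ℚ
open import Data.Rational.Solver using (module +-*-Solver)
open import Algebra.Properties.Group ℚ.+-0-group using (inverseˡ-unique)
open ≡-Reasoning
open +-*-Solver

-- Formal power series

onesS : Series
onesS _ = 1ℚ

*S-congˡ : ∀ {a a′} b → a ≗ a′ → a *S b ≗ a′ *S b
*S-congˡ b a≗a′ n = cong sumℚ (map-cong (λ k → cong (_* b (n ∸ k)) (a≗a′ k)) (upTo (suc n)))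

*S-congʳ : ∀ a {b b′} → b ≗ b′ → a *S b ≗ a *S b′
*S-congʳ a b≗b′ n = cong sumℚ (map-cong (λ k → cong (a k *_) (b≗b′ (n ∸ k))) (upTo (suc n)))

*S-suc : ∀ a b n → (a *S b) (suc n) ≡ a 0 * b (suc n) + ((a ∘ suc) *S b) n
*S-suc a b n = cong (a 0 * b (suc n) +_) (cong sumℚ (begin
  map (λ k → a k * b (suc n ∸ k)) (applyUpTo suc (suc n)) ≡⟨ map-applyUpTo suc _ (suc n) ⟩
  applyUpTo (λ k → a (suc k) * b (n ∸ k)) (suc n)        ≡⟨ map-applyUpTo id _ (suc n) ⟨
  map (λ k → a (suc k) * b (n ∸ k)) (upTo (suc n))       ∎))

*S-linearˡ : ∀ x a a′ b n → ((λ k → x * a k + a′ k) *S b) n ≡ x * (a *S b) n + (a′ *S b) n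
*S-linearˡ x a a′ b zero =
  solve 4 (λ x y y′ z → (x :* y :+ y′) :* z :+ con 0ℚ := x :* (y :* z :+ con 0ℚ) :+ (y′ :* z :+ con 0ℚ))
    refl x (a 0) (a′ 0) (b 0)
*S-linearˡ x a a′ b (suc n) = begin
  ((λ k → x * a k + a′ k) *S b) (suc n)
    ≡⟨ *S-suc (λ k → x * a k + a′ k) b n ⟩
  (x * a 0 + a′ 0) * b (suc n) + ((λ k → x * a (suc k) + a′ (suc k)) *S b) n
    ≡⟨ cong ((x * a 0 + a′ 0) * b (suc n) +_) (*S-linearˡ x (a ∘ suc) (a′ ∘ suc) b n) ⟩
  (x * a 0 + a′ 0) * b (suc n) + (x * ((a ∘ suc) *S b) n + ((a′ ∘ suc) *S b) n)
    ≡⟨ solve 6 (λ x y y′ z s s′ → (x :* y :+ y′) :* z :+ (x :* s :+ s′)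
                                 := x :* (y :* z :+ s) :+ (y′ :* z :+ s′))
         refl x (a 0) (a′ 0) (b (suc n)) (((a ∘ suc) *S b) n) (((a′ ∘ suc) *S b) n) ⟩
  x * (a 0 * b (suc n) + ((a ∘ suc) *S b) n) + (a′ 0 * b (suc n) + ((a′ ∘ suc) *S b) n)
    ≡⟨ cong₂ (λ s s′ → x * s + s′) (*S-suc a b n) (*S-suc a′ b n) ⟨
  x * (a *S b) (suc n) + (a′ *S b) (suc n) ∎

*S-assoc : ∀ a b c n → ((a *S b) *S c) n ≡ (a *S (b *S c)) n
*S-assoc a b c zero =
  solve 3 (λ x y z → (x :* y :+ con 0ℚ) :* z :+ con 0ℚ := x :* (y :* z :+ con 0ℚ) :+ con 0ℚ)
    refl (a 0) (b 0) (c 0)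
*S-assoc a b c (suc n) = begin
  ((a *S b) *S c) (suc n)
    ≡⟨ *S-suc (a *S b) c n ⟩
  (a *S b) 0 * c (suc n) + (((a *S b) ∘ suc) *S c) n
    ≡⟨ cong ((a *S b) 0 * c (suc n) +_) (*S-congˡ c (*S-suc a b) n) ⟩
  (a *S b) 0 * c (suc n) + ((λ k → a 0 * b (suc k) + ((a ∘ suc) *S b) k) *S c) n
    ≡⟨ cong ((a *S b) 0 * c (suc n) +_) (*S-linearˡ (a 0) (b ∘ suc) ((a ∘ suc) *S b) c n) ⟩
  (a *S b) 0 * c (suc n) + (a 0 * ((b ∘ suc) *S c) n + (((a ∘ suc) *S b) *S c) n)
    ≡⟨ cong (λ s → (a *S b) 0 * c (suc n) + (a 0 * ((b ∘ suc) *S c) n + s)) (*S-assoc (a ∘ suc) b c n) ⟩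
  (a 0 * b 0 + 0ℚ) * c (suc n) + (a 0 * ((b ∘ suc) *S c) n + ((a ∘ suc) *S (b *S c)) n)
    ≡⟨ solve 5 (λ x y z s t → (x :* y :+ con 0ℚ) :* z :+ (x :* s :+ t) := x :* (y :* z :+ s) :+ t)
         refl (a 0) (b 0) (c (suc n)) (((b ∘ suc) *S c) n) (((a ∘ suc) *S (b *S c)) n) ⟩
  a 0 * (b 0 * c (suc n) + ((b ∘ suc) *S c) n) + ((a ∘ suc) *S (b *S c)) n
    ≡⟨ cong (λ s → a 0 * s + ((a ∘ suc) *S (b *S c)) n) (*S-suc b c n) ⟨
  a 0 * (b *S c) (suc n) + ((a ∘ suc) *S (b *S c)) n
    ≡⟨ *S-suc a (b *S c) n ⟨
  (a *S (b *S c)) (suc n) ∎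

*S-zeroˡ : ∀ a n → ((λ _ → 0ℚ) *S a) n ≡ 0ℚ
*S-zeroˡ a zero    = solve 1 (λ y → con 0ℚ :* y :+ con 0ℚ := con 0ℚ) refl (a 0)
*S-zeroˡ a (suc n) = begin
  ((λ _ → 0ℚ) *S a) (suc n)              ≡⟨ *S-suc (λ _ → 0ℚ) a n ⟩
  0ℚ * a (suc n) + ((λ _ → 0ℚ) *S a) n  ≡⟨ cong₂ _+_ (ℚ.*-zeroˡ (a (suc n))) (*S-zeroˡ a n) ⟩
  0ℚ                                     ∎

*S-identityˡ : ∀ a n → (oneS *S a) n ≡ a n
*S-identityˡ a zero    = solve 1 (λ y → con 1ℚ :* y :+ con 0ℚ := y) refl (a 0)
*S-identityˡ a (suc n) = begin
  (oneS *S a) (suc n)                     ≡⟨ *S-suc oneS a n ⟩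
  1ℚ * a (suc n) + ((λ _ → 0ℚ) *S a) n   ≡⟨ cong₂ _+_ (ℚ.*-identityˡ (a (suc n))) (*S-zeroˡ a n) ⟩
  a (suc n) + 0ℚ                          ≡⟨ ℚ.+-identityʳ (a (suc n)) ⟩
  a (suc n)                               ∎

xS-*S : ∀ a n → (xS *S a) (suc n) ≡ a n
xS-*S a n = begin
  (xS *S a) (suc n)                 ≡⟨ *S-suc xS a n ⟩
  0ℚ * a (suc n) + ((xS ∘ suc) *S a) n
    ≡⟨ cong₂ _+_ (ℚ.*-zeroˡ (a (suc n))) (*S-congˡ a xS∘suc≗oneS n) ⟩
  0ℚ + (oneS *S a) n                ≡⟨ ℚ.+-identityˡ _ ⟩
  (oneS *S a) n                     ≡⟨ *S-identityˡ a n ⟩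
  a n                               ∎
  where
  xS∘suc≗oneS : xS ∘ suc ≗ oneS
  xS∘suc≗oneS zero    = refl
  xS∘suc≗oneS (suc _) = refl

*S-onesʳ-suc : ∀ a n → (a *S onesS) (suc n) ≡ (a *S onesS) n + a (suc n)
*S-onesʳ-suc a zero    =
  solve 2 (λ x y → x :* con 1ℚ :+ (y :* con 1ℚ :+ con 0ℚ) := (x :* con 1ℚ :+ con 0ℚ) :+ y)
    refl (a 0) (a 1)
*S-onesʳ-suc a (suc n) = begin
  (a *S onesS) (suc (suc n))                            ≡⟨ *S-suc a onesS (suc n) ⟩
  a 0 * 1ℚ + ((a ∘ suc) *S onesS) (suc n)               ≡⟨ cong (a 0 * 1ℚ +_) (*S-onesʳ-suc (a ∘ suc) n) ⟩
  a 0 * 1ℚ + (((a ∘ suc) *S onesS) n + a (suc (suc n))) ≡⟨ ℚ.+-assoc (a 0 * 1ℚ) _ _ ⟨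
  a 0 * 1ℚ + ((a ∘ suc) *S onesS) n + a (suc (suc n))   ≡⟨ cong (_+ a (suc (suc n))) (*S-suc a onesS n) ⟨
  (a *S onesS) (suc n) + a (suc (suc n))                ∎

oneMinusX-*S-ones : oneMinusX *S onesS ≗ oneS
oneMinusX-*S-ones zero          = refl
oneMinusX-*S-ones (suc zero)    = refl
oneMinusX-*S-ones (suc (suc n)) = begin
  (oneMinusX *S onesS) (suc (suc n))  ≡⟨ *S-onesʳ-suc oneMinusX (suc n) ⟩
  (oneMinusX *S onesS) (suc n) + 0ℚ   ≡⟨ ℚ.+-identityʳ _ ⟩
  (oneMinusX *S onesS) (suc n)        ≡⟨ oneMinusX-*S-ones (suc n) ⟩
  0ℚ                                  ∎

zipWith-applyUpTo : ∀ {A B C : Set} (f : A → B → C) g h n →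
                    zipWith f (applyUpTo g n) (applyUpTo h n) ≡ applyUpTo (λ k → f (g k) (h k)) n
zipWith-applyUpTo f g h zero    = refl
zipWith-applyUpTo f g h (suc n) = cong (f (g 0) (h 0) ∷_) (zipWith-applyUpTo f (g ∘ suc) (h ∘ suc) n)

invList-rightInverse : ∀ a b → a 0 ≡ 1ℚ → a *S b ≗ oneS →
                       ∀ n → invList a n ≡ applyUpTo (λ k → b (n ∸ k)) (suc n)
invList-rightInverse a b a₀≡1 ab≗1 zero = cong (_∷ []) (begin
  1ℚ               ≡⟨ ab≗1 0 ⟨
  a 0 * b 0 + 0ℚ   ≡⟨ cong (λ x → x * b 0 + 0ℚ) a₀≡1 ⟩
  1ℚ * b 0 + 0ℚ    ≡⟨ solve 1 (λ y → con 1ℚ :* y :+ con 0ℚ := y) refl (b 0) ⟩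
  b 0              ∎)
invList-rightInverse a b a₀≡1 ab≗1 (suc n) rewrite invList-rightInverse a b a₀≡1 ab≗1 n =
  cong (_∷ _) (sym (trans (inverseˡ-unique (b (suc n)) _ coefficient) (cong -_ (cong sumℚ as-zipWith))))
  where
  coefficient : b (suc n) + ((a ∘ suc) *S b) n ≡ 0ℚ
  coefficient = begin
    b (suc n) + ((a ∘ suc) *S b) n         ≡⟨ cong (_+ ((a ∘ suc) *S b) n) (ℚ.*-identityˡ (b (suc n))) ⟨
    1ℚ * b (suc n) + ((a ∘ suc) *S b) n    ≡⟨ cong (λ x → x * b (suc n) + ((a ∘ suc) *S b) n) a₀≡1 ⟨
    a 0 * b (suc n) + ((a ∘ suc) *S b) n   ≡⟨ *S-suc a b n ⟨
    (a *S b) (suc n)                       ≡⟨ ab≗1 (suc n) ⟩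
    0ℚ                                     ∎
  as-zipWith : map (λ k → a (suc k) * b (n ∸ k)) (upTo (suc n))
               ≡ zipWith _*_ (map (a ∘ suc) (upTo (suc n))) (applyUpTo (λ k → b (n ∸ k)) (suc n))
  as-zipWith = begin
    map (λ k → a (suc k) * b (n ∸ k)) (upTo (suc n))
      ≡⟨ map-upTo _ (suc n) ⟩
    applyUpTo (λ k → a (suc k) * b (n ∸ k)) (suc n)
      ≡⟨ zipWith-applyUpTo _*_ (a ∘ suc) (λ k → b (n ∸ k)) (suc n) ⟨
    zipWith _*_ (applyUpTo (a ∘ suc) (suc n)) (applyUpTo (λ k → b (n ∸ k)) (suc n))
      ≡⟨ cong (λ xs → zipWith _*_ xs (applyUpTo (λ k → b (n ∸ k)) (suc n))) (map-upTo (a ∘ suc) (suc n)) ⟨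
    zipWith _*_ (map (a ∘ suc) (upTo (suc n))) (applyUpTo (λ k → b (n ∸ k)) (suc n)) ∎

inv₁-unique : ∀ a b → a 0 ≡ 1ℚ → a *S b ≗ oneS → inv₁ a ≗ b
inv₁-unique a b a₀≡1 ab≗1 n rewrite invList-rightInverse a b a₀≡1 ab≗1 n = refl

inv₁-oneMinusX²-*S : ∀ B r → B 0 ≡ 1ℚ → B *S r ≗ onesS →
                      inv₁ ((oneMinusX *S oneMinusX) *S B) ≗ r *S onesS
inv₁-oneMinusX²-*S B r B₀≡1 Br≗1 =
  inv₁-unique ((D *S D) *S B) (r *S onesS) (cong (λ x → (1ℚ * 1ℚ + 0ℚ) * x + 0ℚ) B₀≡1) λ n → begin
    (((D *S D) *S B) *S (r *S onesS)) n  ≡⟨ *S-assoc (D *S D) B (r *S onesS) n ⟩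
    ((D *S D) *S (B *S (r *S onesS))) n  ≡⟨ *S-congʳ (D *S D) (*S-assoc B r onesS) n ⟨
    ((D *S D) *S ((B *S r) *S onesS)) n  ≡⟨ *S-congʳ (D *S D) (*S-congˡ onesS Br≗1) n ⟩
    ((D *S D) *S (onesS *S onesS)) n     ≡⟨ *S-assoc D D (onesS *S onesS) n ⟩
    (D *S (D *S (onesS *S onesS))) n     ≡⟨ *S-congʳ D (*S-assoc D onesS onesS) n ⟨
    (D *S ((D *S onesS) *S onesS)) n     ≡⟨ *S-congʳ D (*S-congˡ onesS oneMinusX-*S-ones) n ⟩
    (D *S (oneS *S onesS)) n             ≡⟨ *S-congʳ D (*S-identityˡ onesS) n ⟩
    (D *S onesS) n                       ≡⟨ oneMinusX-*S-ones n ⟩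
    oneS n                               ∎
  where D = oneMinusX

∷-++ : ∀ {A : Set} {a b} (x : A) (xs : Vector A a) (ys : Vector A b) →
       (x Vector.∷ xs) ++ ys ≗ x Vector.∷ (xs ++ ys)
∷-++         x xs ys Fin.zero    = refl
∷-++ {a = a} x xs ys (Fin.suc i) = [,]-map (splitAt a i)

module Bernoulli (p : ℚ) where

  q : ℚ
  q = 1ℚ - p

  E : (k : ℕ) → (Vector Bool k → ℚ) → ℚ
  E = expect p

  E-cong : ∀ k {f g : Vector Bool k → ℚ} → (∀ ω → f ω ≡ g ω) → E k f ≡ E k g
  E-cong zero    f≡g = f≡g _
  E-cong (suc k) f≡g = cong₂ (λ x y → p * x + q * y) (E-cong k (λ _ → f≡g _)) (E-cong k (λ _ → f≡g _))

  average-self : ∀ x → p * x + q * x ≡ x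
  average-self = solve 2 (λ p x → p :* x :+ (con 1ℚ :- p) :* x := x) refl p

  E-const : ∀ k x → E k (λ _ → x) ≡ x
  E-const zero    x = refl
  E-const (suc k) x = trans (cong (λ y → p * y + q * y) (E-const k x)) (average-self x)

  E-+ : ∀ k (f g : Vector Bool k → ℚ) → E k (λ ω → f ω + g ω) ≡ E k f + E k g
  E-+ zero    f g = refl
  E-+ (suc k) f g = trans (cong₂ (λ x y → p * x + q * y) (E-+ k _ _) (E-+ k _ _))
    (solve 6 (λ p q a b c d → p :* (a :+ b) :+ q :* (c :+ d) := (p :* a :+ q :* c) :+ (p :* b :+ q :* d))
      refl p q _ _ _ _)

  E-*ˡ : ∀ k x (f : Vector Bool k → ℚ) → E k (λ ω → x * f ω) ≡ x * E k f
  E-*ˡ zero    x f = refl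
  E-*ˡ (suc k) x f = trans (cong₂ (λ y z → p * y + q * z) (E-*ˡ k x _) (E-*ˡ k x _))
    (solve 5 (λ p q x a b → p :* (x :* a) :+ q :* (x :* b) := x :* (p :* a :+ q :* b)) refl p q x _ _)

  E-sum : ∀ {A : Set} k (f : A → Vector Bool k → ℚ) xs →
          E k (λ ω → sumℚ (map (λ i → f i ω) xs)) ≡ sumℚ (map (λ i → E k (f i)) xs)
  E-sum k f []       = E-const k 0ℚ
  E-sum k f (x ∷ xs) = trans (E-+ k (f x) _) (cong (E k (f x) +_) (E-sum k f xs))

  E-comm : ∀ a b (f : Vector Bool a → Vector Bool b → ℚ) →
           E a (λ v → E b (λ u → f v u)) ≡ E b (λ u → E a (λ v → f v u))
  E-comm zero    b f = refl
  E-comm (suc a) b f =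
    trans (cong₂ (λ x y → p * x + q * y) (E-comm a b _) (E-comm a b _))
          (sym (trans (E-+ b _ _) (cong₂ _+_ (E-*ˡ b p _) (E-*ˡ b q _))))

  E-suc : ∀ k (f : Vector Bool (suc k) → ℚ) → Congruent _≗_ _≡_ f →
          E (suc k) f ≡ p * E k (λ ω → f (true Vector.∷ ω)) + q * E k (λ ω → f (false Vector.∷ ω))
  E-suc k f f-cong = cong₂ (λ x y → p * x + q * y)
    (E-cong k (λ _ → f-cong (∷-cong refl (λ _ → refl))))
    (E-cong k (λ _ → f-cong (∷-cong refl (λ _ → refl))))

  E-tail : ∀ k (f : Vector Bool k → ℚ) → E (suc k) (f ∘ tail) ≡ E k f
  E-tail k f = average-self (E k f)

  E-++ : ∀ a {b} (f : Vector Bool (a ℕ.+ b) → ℚ) → Congruent _≗_ _≡_ f →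
         E (a ℕ.+ b) f ≡ E a (λ v → E b (λ u → f (v ++ u)))
  E-++ zero    {b} f f-cong = E-cong b (λ _ → f-cong (λ _ → refl))
  E-++ (suc a) {b} f f-cong = begin
    E (suc a ℕ.+ b) f
      ≡⟨ E-suc (a ℕ.+ b) f f-cong ⟩
    p * E (a ℕ.+ b) (λ ω → f (true Vector.∷ ω)) + q * E (a ℕ.+ b) (λ ω → f (false Vector.∷ ω))
      ≡⟨ cong₂ (λ x y → p * x + q * y) (split true) (split false) ⟩
    p * E a (λ v → E b (λ u → f ((true Vector.∷ v) ++ u)))
      + q * E a (λ v → E b (λ u → f ((false Vector.∷ v) ++ u)))
      ≡⟨ E-suc a (λ v → E b (λ u → f (v ++ u)))
               (λ v≗v′ → E-cong b (λ u → f-cong (++-cong _ _ v≗v′ (λ _ → refl)))) ⟨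
    E (suc a) (λ v → E b (λ u → f (v ++ u))) ∎
    where
    split : ∀ x → E (a ℕ.+ b) (λ ω → f (x Vector.∷ ω)) ≡ E a (λ v → E b (λ u → f ((x Vector.∷ v) ++ u)))
    split x = trans (E-++ a (λ ω → f (x Vector.∷ ω)) (λ ω≗ω′ → f-cong (∷-cong refl ω≗ω′)))
                    (E-cong a (λ v → E-cong b (λ u → f-cong (λ i → sym (∷-++ x v u i)))))

  E-dropFirstColumn : ∀ r c (h : Vector Bool (r ℕ.* c) → ℚ) → Congruent _≗_ _≡_ h →
                      E (r ℕ.* suc c) (h ∘ dropFirstColumn r c) ≡ E (r ℕ.* c) h
  E-dropFirstColumn zero    c h h-cong = h-cong (λ ())
  E-dropFirstColumn (suc r) c h h-cong = begin
    E (suc c ℕ.+ r ℕ.* suc c) (h ∘ dropFirstColumn (suc r) c)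
      ≡⟨ E-++ (suc c) _ (h-cong ∘ dropFirstColumn-cong (suc r) c) ⟩
    E (suc c) (λ v → E (r ℕ.* suc c) (λ u → h (dropFirstColumn (suc r) c (v ++ u))))
      ≡⟨ E-cong (suc c) (λ v → E-cong (r ℕ.* suc c) (λ u → h-cong
           (++-cong _ _ (lookup-++ˡ v u ∘ Fin.suc) (dropFirstColumn-cong r c (lookup-++ʳ v u))))) ⟩
    E (suc c) (λ v → E (r ℕ.* suc c) (λ u → h (tail v ++ dropFirstColumn r c u)))
      ≡⟨ E-cong (suc c) (λ v → E-dropFirstColumn r c (λ z → h (tail v ++ z))
                                   (h-cong ∘ ++-cong (tail v) (tail v) (λ _ → refl))) ⟩
    E (suc c) (λ v → E (r ℕ.* c) (λ z → h (tail v ++ z)))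
      ≡⟨ E-tail c (λ y → E (r ℕ.* c) (λ z → h (y ++ z))) ⟩
    E c (λ y → E (r ℕ.* c) (λ z → h (y ++ z)))
      ≡⟨ E-++ c h h-cong ⟨
    E (c ℕ.+ r ℕ.* c) h ∎

  E-toMatrix-suc : ∀ n φ → EdgeDetermined (suc n) φ →
                   E (suc n ℕ.* suc n) (φ ∘ toMatrix (suc n) (suc n))
                   ≡ E (suc n) (λ v → E (n ℕ.* n) (λ ω → φ (extend v (toMatrix n n ω))))
  E-toMatrix-suc n φ φ-det = begin
    E (suc n ℕ.* suc n) (φ ∘ toMatrix (suc n) (suc n))
      ≡⟨ E-++ (suc n) _ (λ ω≗ω′ → φ-det (λ {i} {j} _ _ → toMatrix-cong (suc n) (suc n) ω≗ω′ i j)) ⟩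
    E (suc n) (λ v → E (n ℕ.* suc n) (λ u → φ (toMatrix (suc n) (suc n) (v ++ u))))
      ≡⟨ E-cong (suc n) (λ v → E-cong (n ℕ.* suc n) (λ u → φ-det (agree v u))) ⟩
    E (suc n) (λ v → E (n ℕ.* suc n) (λ u → φ (extend v (toMatrix n n (dropFirstColumn n n u)))))
      ≡⟨ E-cong (suc n) (λ v → E-dropFirstColumn n n (λ ω → φ (extend v (toMatrix n n ω)))
           (λ ω≗ω′ → φ-det (λ {i} {j} _ _ → extend-cong v (toMatrix-cong n n ω≗ω′) i j))) ⟩
    E (suc n) (λ v → E (n ℕ.* n) (λ ω → φ (extend v (toMatrix n n ω)))) ∎
    where
    agree : ∀ v u {i j} → i ℕ.< j → j ℕ.< suc n →
            toMatrix (suc n) (suc n) (v ++ u) i j ≡ extend v (toMatrix n n (dropFirstColumn n n u)) i j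
    agree v u {zero}  {j}     _ _ = toRow-cong (lookup-++ˡ v u) j
    agree v u {suc i} {suc j} _ _ =
      trans (toMatrix-cong n (suc n) (lookup-++ʳ v u) i (suc j)) (toMatrix-dropFirstColumn n n u i j)

ℕ→ℚ-suc : ∀ n → ℕ→ℚ (suc n) ≡ 1ℚ + ℕ→ℚ n
ℕ→ℚ-suc n = sym (trans (cong (λ x → 1ℚ + x) (ℚ.normalize-coprime (Coprime.sym (Coprime.1-coprimeTo n))))
  (cong (λ m → (ℤ.+ 1 ℤ.+ m) / 1) (trans (ℤ.+◃n≡+n (n ℕ.* 1)) (cong ℤ.+_ (ℕ.*-identityʳ n)))))

^ℚ-+ : ∀ x m n → x ^ℚ (m ℕ.+ n) ≡ x ^ℚ m * x ^ℚ n
^ℚ-+ x zero    n = sym (ℚ.*-identityˡ _)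
^ℚ-+ x (suc m) n = trans (cong (x *_) (^ℚ-+ x m n)) (sym (ℚ.*-assoc x _ _))

[2+k]C2 : ∀ k → suc (suc k) C 2 ≡ suc k ℕ.+ suc k C 2
[2+k]C2 k = trans (sym (nCk+nC[k+1]≡[n+1]C[k+1] (suc k) 1)) (cong (ℕ._+ suc k C 2) (nC1≡n (suc k)))

module StateLaw (p : ℚ) where
  open Bernoulli p

  randomState : (n : ℕ) → Config (suc n) → ℕ × ℕ
  randomState n ω = state n (toMatrix (suc n) (suc n) ω)

  stateE : ℕ → (ℕ × ℕ → ℚ) → ℚ
  stateE n φ = E (suc n ℕ.* suc n) (φ ∘ randomState n)

  stateE-cong : ∀ n {φ ψ} → (∀ s → proj₂ s ℕ.≤ n → φ s ≡ ψ s) → stateE n φ ≡ stateE n ψ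
  stateE-cong n {φ} {ψ} φ≡ψ =
    E-cong (suc n ℕ.* suc n) {φ ∘ randomState n} {ψ ∘ randomState n} (λ ω → φ≡ψ _ (state-bound n _))

  stateE-const : ∀ n x → stateE n (λ _ → x) ≡ x
  stateE-const n = E-const (suc n ℕ.* suc n)

  stateE-+ : ∀ n φ ψ → stateE n (λ s → φ s + ψ s) ≡ stateE n φ + stateE n ψ
  stateE-+ n φ ψ = E-+ (suc n ℕ.* suc n) (φ ∘ randomState n) (ψ ∘ randomState n)

  stateE-*ˡ : ∀ n x φ → stateE n (λ s → x * φ s) ≡ x * stateE n φ
  stateE-*ˡ n x φ = E-*ˡ (suc n ℕ.* suc n) x (φ ∘ randomState n)

  stateE-sum : ∀ n (φ : ℕ → ℕ × ℕ → ℚ) xs →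
               stateE n (λ s → sumℚ (map (λ k → φ k s) xs)) ≡ sumℚ (map (λ k → stateE n (φ k)) xs)
  stateE-sum n φ = E-sum (suc n ℕ.* suc n) (λ k → φ k ∘ randomState n)

  transition : (ℕ × ℕ → ℚ) → ℕ × ℕ → ℚ
  transition φ (c , e) = q ^ℚ suc e * φ (c , suc e) + (1ℚ - q ^ℚ suc e) * φ (suc c , 0)

  E-noneUpTo : ∀ k e → e ℕ.< k → ∀ x y →
               E k (λ v → if noneUpTo (toRow v) e then x else y) ≡ q ^ℚ suc e * x + (1ℚ - q ^ℚ suc e) * y
  E-noneUpTo (suc k) zero _ x y rewrite E-const k x | E-const k y =
    solve 3 (λ p x y → p :* y :+ (con 1ℚ :- p) :* x
                       := ((con 1ℚ :- p) :* con 1ℚ) :* x :+ (con 1ℚ :- (con 1ℚ :- p) :* con 1ℚ) :* y)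
      refl p x y
  E-noneUpTo (suc k) (suc e) (s≤s e<k) x y rewrite E-const k y | E-noneUpTo k e e<k x y =
    solve 4 (λ p Q x y → p :* y :+ (con 1ℚ :- p) :* (Q :* x :+ (con 1ℚ :- Q) :* y)
                       := ((con 1ℚ :- p) :* Q) :* x :+ (con 1ℚ :- (con 1ℚ :- p) :* Q) :* y)
      refl p (q ^ℚ suc e) x y

  E-advance : ∀ k s → proj₂ s ℕ.< k → ∀ φ → E k (λ v → φ (advance s (toRow v))) ≡ transition φ s
  E-advance k (c , e) e<k φ =
    trans (E-cong k (λ v → if-float φ (noneUpTo (toRow v) e))) (E-noneUpTo k e e<k _ _)

  stateE-suc : ∀ n φ → stateE (suc n) φ ≡ stateE n (transition φ)
  stateE-suc n φ = begin
    stateE (suc n) φ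
      ≡⟨ E-toMatrix-suc (suc n) (φ ∘ state (suc n)) (cong φ ∘ state-edgeDetermined (suc n)) ⟩
    E (suc (suc n)) (λ v → E (suc n ℕ.* suc n) (λ ω → φ (state (suc n) (extend v (W ω)))))
      ≡⟨ E-comm (suc (suc n)) (suc n ℕ.* suc n) (λ v ω → φ (state (suc n) (extend v (W ω)))) ⟩
    E (suc n ℕ.* suc n) (λ ω → E (suc (suc n)) (λ v → φ (advance (state n (W ω)) (toRow (tail v)))))
      ≡⟨ E-cong (suc n ℕ.* suc n) (λ ω → E-tail (suc n) (λ v → φ (advance (state n (W ω)) (toRow v)))) ⟩
    E (suc n ℕ.* suc n) (λ ω → E (suc n) (λ v → φ (advance (state n (W ω)) (toRow v))))
      ≡⟨ E-cong (suc n ℕ.* suc n) (λ ω →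
           E-advance (suc n) (state n (W ω)) (s≤s (state-bound n (W ω))) φ) ⟩
    stateE n (transition φ) ∎
    where
    W = toMatrix (suc n) (suc n)

  δ : ℕ → ℕ → ℚ
  δ k e = if k ℕ.≡ᵇ e then 1ℚ else 0ℚ

  δ-scale : ∀ (x : ℕ → ℚ) k e → x e * δ k e ≡ x k * δ k e
  δ-scale x k e with k ℕ.≡ᵇ e in k≡ᵇe
  ... | true  rewrite ℕ.≡ᵇ⇒≡ k e (subst T (sym k≡ᵇe) _) = refl
  ... | false = trans (ℚ.*-zeroʳ (x e)) (sym (ℚ.*-zeroʳ (x k)))

  sum-δ : ∀ m e → e ℕ.< m → sumℚ (applyUpTo (λ k → δ k e) m) ≡ 1ℚ
  sum-δ (suc m) zero    _         = trans (cong (1ℚ +_) (sum-zeros m)) (ℚ.+-identityʳ 1ℚ)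
    where
    sum-zeros : ∀ m → sumℚ (applyUpTo (λ _ → 0ℚ) m) ≡ 0ℚ
    sum-zeros zero    = refl
    sum-zeros (suc m) = trans (ℚ.+-identityˡ _) (sum-zeros m)
  sum-δ (suc m) (suc e) (s≤s e<m) = trans (ℚ.+-identityˡ _) (sum-δ m e e<m)

  B : Series
  B = BSeries p

  B-suc : ∀ k → B (suc k) ≡ q ^ℚ suc k * B k
  B-suc k = trans (cong (q ^ℚ_) ([2+k]C2 k)) (^ℚ-+ q (suc k) (suc k C 2))

  climbProb : Series
  climbProb n = stateE n (δ 0 ∘ proj₂)

  climbProb-suc : ∀ n → climbProb (suc n) ≡ stateE n (λ s → 1ℚ - q ^ℚ suc (proj₂ s))
  climbProb-suc n = trans (stateE-suc n (δ 0 ∘ proj₂)) (stateE-cong n (λ (_ , e) _ →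
    solve 1 (λ Q → Q :* con 0ℚ :+ (con 1ℚ :- Q) :* con 1ℚ := con 1ℚ :- Q) refl (q ^ℚ suc e)))

  stateE-δ : ∀ k n → k ℕ.≤ n → stateE n (δ k ∘ proj₂) ≡ B k * climbProb (n ∸ k)
  stateE-δ zero    n       _         = sym (ℚ.*-identityˡ (climbProb n))
  stateE-δ (suc k) (suc n) (s≤s k≤n) = begin
    stateE (suc n) (δ (suc k) ∘ proj₂)
      ≡⟨ stateE-suc n (δ (suc k) ∘ proj₂) ⟩
    stateE n (λ s → q ^ℚ suc (proj₂ s) * δ k (proj₂ s) + (1ℚ - q ^ℚ suc (proj₂ s)) * 0ℚ)
      ≡⟨ stateE-cong n (λ (_ , e) _ → trans (cong (q ^ℚ suc e * δ k e +_) (ℚ.*-zeroʳ (1ℚ - q ^ℚ suc e)))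
                                   (trans (ℚ.+-identityʳ _) (δ-scale (λ i → q ^ℚ suc i) k e))) ⟩
    stateE n (λ s → q ^ℚ suc k * δ k (proj₂ s))
      ≡⟨ stateE-*ˡ n (q ^ℚ suc k) (δ k ∘ proj₂) ⟩
    q ^ℚ suc k * stateE n (δ k ∘ proj₂)
      ≡⟨ cong (q ^ℚ suc k *_) (stateE-δ k n k≤n) ⟩
    q ^ℚ suc k * (B k * climbProb (n ∸ k))
      ≡⟨ ℚ.*-assoc (q ^ℚ suc k) (B k) (climbProb (n ∸ k)) ⟨
    q ^ℚ suc k * B k * climbProb (n ∸ k)
      ≡⟨ cong (_* climbProb (n ∸ k)) (B-suc k) ⟨
    B (suc k) * climbProb (n ∸ k) ∎

  B*climbProb : B *S climbProb ≗ onesS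
  B*climbProb n = begin
    sumℚ (map (λ k → B k * climbProb (n ∸ k)) (upTo (suc n)))
      ≡⟨ cong sumℚ (map-cong-local {f = λ k → B k * climbProb (n ∸ k)} {g = λ k → stateE n (δ k ∘ proj₂)}
           (applyUpTo⁺₁ id (suc n) (λ k<1+n → sym (stateE-δ _ n (ℕ.≤-pred k<1+n))))) ⟩
    sumℚ (map (λ k → stateE n (δ k ∘ proj₂)) (upTo (suc n)))
      ≡⟨ stateE-sum n (λ k → δ k ∘ proj₂) (upTo (suc n)) ⟨
    stateE n (λ s → sumℚ (map (λ k → δ k (proj₂ s)) (upTo (suc n))))
      ≡⟨ stateE-cong n (λ (_ , e) e≤n →
           trans (cong sumℚ (map-upTo (λ k → δ k e) (suc n))) (sum-δ (suc n) e (s≤s e≤n))) ⟩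
    stateE n (λ _ → 1ℚ)
      ≡⟨ stateE-const n 1ℚ ⟩
    1ℚ ∎

  expectedMax : ℕ → ℚ
  expectedMax n = stateE n (ℕ→ℚ ∘ proj₁)

  expectedMax-suc : ∀ n → expectedMax (suc n) ≡ expectedMax n + climbProb (suc n)
  expectedMax-suc n = begin
    stateE (suc n) (ℕ→ℚ ∘ proj₁)
      ≡⟨ stateE-suc n (ℕ→ℚ ∘ proj₁) ⟩
    stateE n (transition (ℕ→ℚ ∘ proj₁))
      ≡⟨ stateE-cong n (λ (c , e) _ →
           trans (cong (λ y → q ^ℚ suc e * ℕ→ℚ c + (1ℚ - q ^ℚ suc e) * y) (ℕ→ℚ-suc c))
                 (solve 2 (λ Q x → Q :* x :+ (con 1ℚ :- Q) :* (con 1ℚ :+ x) := x :+ (con 1ℚ :- Q))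
                    refl (q ^ℚ suc e) (ℕ→ℚ c))) ⟩
    stateE n (λ s → ℕ→ℚ (proj₁ s) + (1ℚ - q ^ℚ suc (proj₂ s)))
      ≡⟨ stateE-+ n (ℕ→ℚ ∘ proj₁) (λ s → 1ℚ - q ^ℚ suc (proj₂ s)) ⟩
    expectedMax n + stateE n (λ s → 1ℚ - q ^ℚ suc (proj₂ s))
      ≡⟨ cong (expectedMax n +_) (climbProb-suc n) ⟨
    expectedMax n + climbProb (suc n) ∎

  1+expectedMax : ∀ n → 1ℚ + expectedMax n ≡ (climbProb *S onesS) n
  1+expectedMax zero    = begin
    1ℚ + expectedMax 0               ≡⟨ cong (1ℚ +_) (stateE-const 0 0ℚ) ⟩
    1ℚ                               ≡⟨ stateE-const 0 1ℚ ⟨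
    climbProb 0                      ≡⟨ ℚ.*-identityʳ (climbProb 0) ⟨
    climbProb 0 * 1ℚ                 ≡⟨ ℚ.+-identityʳ _ ⟨
    (climbProb *S onesS) 0           ∎
  1+expectedMax (suc n) = begin
    1ℚ + expectedMax (suc n)                      ≡⟨ cong (1ℚ +_) (expectedMax-suc n) ⟩
    1ℚ + (expectedMax n + climbProb (suc n))      ≡⟨ ℚ.+-assoc 1ℚ (expectedMax n) (climbProb (suc n)) ⟨
    1ℚ + expectedMax n + climbProb (suc n)        ≡⟨ cong (_+ climbProb (suc n)) (1+expectedMax n) ⟩
    (climbProb *S onesS) n + climbProb (suc n)    ≡⟨ *S-onesʳ-suc climbProb n ⟨
    (climbProb *S onesS) (suc n)                  ∎

-- The identity is polynomial in p.
theorem1 : (p : ℚ) → 0ℚ < p → p < 1ℚ →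
           (X : (m : ℕ) → Config (suc m) → ℕ) →
           ((m : ℕ) (ω : Config (suc m)) → IsMaxPathWeight m (edgeW ω) (X m ω)) →
           (n : ℕ) →
           gSeries p X n ≡ (oneS +S (xS *S inv₁ ((oneMinusX *S oneMinusX) *S BSeries p))) n
theorem1 p _ _ X isMax zero    = refl
theorem1 p _ _ X isMax (suc m) = begin
  1ℚ + E (suc m ℕ.* suc m) (λ ω → ℕ→ℚ (X m ω))
    ≡⟨ cong (1ℚ +_) (E-cong (suc m ℕ.* suc m) (λ ω → cong ℕ→ℚ (maxPathWeight≡state ω (isMax m ω)))) ⟩
  1ℚ + expectedMax m
    ≡⟨ 1+expectedMax m ⟩
  (climbProb *S onesS) m
    ≡⟨ inv₁-oneMinusX²-*S B climbProb refl B*climbProb m ⟨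
  inv₁ ((oneMinusX *S oneMinusX) *S B) m
    ≡⟨ xS-*S (inv₁ ((oneMinusX *S oneMinusX) *S B)) m ⟨
  (xS *S inv₁ ((oneMinusX *S oneMinusX) *S B)) (suc m)
    ≡⟨ ℚ.+-identityˡ _ ⟨
  (oneS +S (xS *S inv₁ ((oneMinusX *S oneMinusX) *S B))) (suc m) ∎
  where
  open Bernoulli p
  open StateLaw p
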